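{- Let $n\ge 1$ and let $S=(s_1,\dots,s_n)$ be a permutation of $[n]$, viewed as a search sequence. Let $I_p=\mathcal{M}(S)=\{(s_i,-i): i\in[n]\}$ and let $I_f=\emptyset$ be the flat initial tree. Then $\textsc{Greedy}_{I_p}(S)=\textsc{Greedy}_{I_f}(S)$.
   Context: Geometric view of binary search trees: a search sequence $S=(s_1,\dots,s_n)$ of keys in $[n]$ is the point set $\{(s_i,i)\}$ in the plane (x-coordinate = key, y-coordinate = time). The mirror $\mathcal{M}(S)$ of a point set is its reflection across the $x$-axis: $(s_i,i)\mapsto(s_i,-i)$. An initial tree is a finite set of points with negative $y$-coordinates present before any search; the flat initial tree $I_f$ is the empty set. For two points $p,q$ not on a common horizontal or vertical line, $\square_{pq}$ denotes the closed axis-parallel rectangle with corners $p,q$; it is arborally satisfied in a point set $X$ if some point of $X\setminus\{p,q\}$ lies in it. The algorithm $\textsc{Greedy}$ with initial tree $I$ on $S$: start with $X:=I$; for $i=1,\dots,n$ in order, let $X_{<i}$ be the current set (all points with $y<i$); for every point $z\in X_{<i}$ with $z.x\neq s_i$ such that $\square_{(s_i,i)z}$ contains no point of $X_{<i}\cup\{(s_i,i)\}$ other than its two corners, add the point $(z.x,i)$ (it "touches" key $z.x$ at time $i$); then add $(s_i,i)$ and all these touched points to $X$. The cost $\textsc{Greedy}_I(S)$ is $n$ plus the total number of touched points added over all times $1,\dots,n$. -}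

module Defs where

open import Data.Nat as ℕ using (ℕ; zero; suc; _⊓_; _⊔_)
open import Data.Integer as ℤ using (ℤ; +_; -_)
open import Data.Bool using (Bool; true; false; _∧_; _∨_; not)
open import Data.Product using (_×_; _,_; proj₁; proj₂)
open import Data.Product.Properties using (≡-dec)
open import Data.List using (List; []; _∷_; _++_; map; filterᵇ; length; deduplicate)
open import Data.Bool.ListAction using (all)
open import Data.Fin using (Fin; toℕ)
open import Data.List using (allFin)
open import Relation.Nullary.Decidable using (⌊_⌋; ¬?)
open import Relation.Binary.PropositionalEquality using (_≡_)

-- A point in the plane: x-coordinate (key) in ℕ, y-coordinate (time) in ℤ.
Point : Set
Point = ℕ × ℤ

_==ᵖ_ : Point → Point → Bool
p ==ᵖ q = ⌊ ≡-dec ℕ._≟_ ℤ._≟_ p q ⌋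

inRect : Point → Point → Point → Bool
inRect (px , py) (qx , qy) (wx , wy) =
  ⌊ (px ⊓ qx) ℕ.≤? wx ⌋ ∧ ⌊ wx ℕ.≤? (px ⊔ qx) ⌋ ∧
  ⌊ (py ℤ.⊓ qy) ℤ.≤? wy ⌋ ∧ ⌊ wy ℤ.≤? (py ℤ.⊔ qy) ⌋

emptyRect : List Point → Point → Point → Bool
emptyRect Y p z = all (λ w → not (inRect p z w) ∨ (w ==ᵖ z) ∨ (w ==ᵖ p)) Y

-- Keys touched by Greedy at time t when searching key s, with current set X
-- (all points of X have y < t).  Duplicated keys are removed (the touched
-- points (z.x , t) form a set).
touchedKeys : List Point → ℕ → ℤ → List ℕ
touchedKeys X s t =
  deduplicate ℕ._≟_
    (map proj₁ (filterᵇ (λ z → not ⌊ proj₁ z ℕ.≟ s ⌋ ∧ emptyRect ((s , t) ∷ X) (s , t) z) X))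

greedyRun : List Point → ℕ → List ℕ → List Point × ℕ
greedyRun X t [] = X , 0
greedyRun X t (s ∷ ss) =
  let T  = touchedKeys X s (+ t)
      X' = X ++ ((s , + t) ∷ map (λ x → (x , + t)) T)
      r  = greedyRun X' (suc t) ss
  in proj₁ r , length T ℕ.+ proj₂ r

-- Cost of Greedy with initial tree I on search sequence S = (s_1,…,s_n)
-- (point s_i at time i): n plus total number of touched points.
Greedy : List Point → List ℕ → ℕ
Greedy I S = length S ℕ.+ proj₂ (greedyRun I 1 S)

mirrorFrom : ℕ → List ℕ → List Point
mirrorFrom t [] = []
mirrorFrom t (s ∷ ss) = (s , - (+ t)) ∷ mirrorFrom (suc t) ss

mirror : List ℕ → List Point
mirror = mirrorFrom 1

flatTree : List Point
flatTree = []

-- The search sequence of a permutation σ of [n] (keys 1..n): s_i = σ(i) + 1.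
seqOf : ∀ {n} → (Fin n → Fin n) → List ℕ
seqOf {n} σ = map (λ i → suc (toℕ (σ i))) (allFin n)

-- Run Greedy from the mirror tree and from the flat tree side by side.  After t searches the
-- mirrored run's point set is the flat run's set X together with all of M(S), and no point of
-- M(S) is ever touched or obstructs a touch:
--   * the mirror (k, -m) of an earlier search is shielded by the search point (k, m) ∈ X;
--   * the mirror (k, -m) of a later search is shielded by (s, -t), the mirror of the current
--     search (s, t), and (s, -t) itself has the searched key;
--   * M(S) lies below the x-axis, so it misses every rectangle spanned by (s, t) and a point of X.
-- Hence both runs touch the same keys at every step.

module Submission where

open import Defs
open import Data.Nat as ℕ using (ℕ; _≤_; suc; _<_; _⊓_; _⊔_)
open import Data.Fin using (Fin)
open import Function.Definitions using (Injective)
import Data.Nat.Properties as ℕ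
open import Data.Integer as ℤ using (ℤ; +_; -[1+_]; 0ℤ)
import Data.Integer.Properties as ℤ
open import Data.Bool using (Bool; true; false; _∧_; _∨_; not)
open import Data.Bool.Properties using (∧-zeroʳ)
open import Data.Product using (_×_; _,_; proj₁; proj₂; ∃-syntax)
open import Data.Product.Properties using (≡-dec)
open import Data.Sum using (inj₁; inj₂)
open import Data.List using (List; []; _∷_; _++_; map; filterᵇ; length; deduplicate; [_])
open import Data.List.Properties using (++-assoc; ++-identityʳ; filter-++)
open import Data.List.Membership.Propositional using (_∈_)
open import Data.List.Membership.Propositional.Properties using (∈-++⁺ˡ; ∈-++⁺ʳ)
open import Data.List.Relation.Unary.All as All using (All; []; _∷_)
open import Data.List.Relation.Unary.All.Properties using (++⁺; map⁺)
open import Data.List.Relation.Unary.Any using (here; there)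
open import Function using (_∘_)
open import Relation.Binary.PropositionalEquality
  using (_≡_; _≢_; refl; cong; cong₂; sym; trans; module ≡-Reasoning)
open import Relation.Nullary using (Dec; ¬_)
open import Relation.Nullary.Decidable using (⌊_⌋; isYes≗does; dec-true; dec-false)

⌊⌋-true : ∀ {A : Set} (a? : Dec A) → A → ⌊ a? ⌋ ≡ true
⌊⌋-true a? a = trans (isYes≗does a?) (dec-true a? a)

⌊⌋-false : ∀ {A : Set} (a? : Dec A) → ¬ A → ⌊ a? ⌋ ≡ false
⌊⌋-false a? ¬a = trans (isYes≗does a?) (dec-false a? ¬a)

filterᵇ-none : ∀ {A : Set} {f : A → Bool} {xs} → All (λ x → f x ≡ false) xs → filterᵇ f xs ≡ []
filterᵇ-none [] = refl
filterᵇ-none (fx≡false ∷ rest) rewrite fx≡false = filterᵇ-none rest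

filterᵇ-cong : ∀ {A : Set} {f g : A → Bool} {xs} → All (λ x → f x ≡ g x) xs →
               filterᵇ f xs ≡ filterᵇ g xs
filterᵇ-cong [] = refl
filterᵇ-cong {f = f} {g} {x ∷ _} (fx≡gx ∷ rest) with f x | g x | fx≡gx
... | false | .false | refl = filterᵇ-cong rest
... | true  | .true  | refl = cong (x ∷_) (filterᵇ-cong rest)

inRect-intro : ∀ {px qx wx : ℕ} {py qy wy : ℤ} →
               px ⊓ qx ≤ wx → wx ≤ px ⊔ qx → py ℤ.⊓ qy ℤ.≤ wy → wy ℤ.≤ py ℤ.⊔ qy →
               inRect (px , py) (qx , qy) (wx , wy) ≡ true
inRect-intro {px} {qx} {wx} {py} {qy} {wy} x₁ x₂ y₁ y₂
  = cong₂ _∧_ (⌊⌋-true (px ⊓ qx ℕ.≤? wx) x₁)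
    (cong₂ _∧_ (⌊⌋-true (wx ℕ.≤? px ⊔ qx) x₂)
      (cong₂ _∧_ (⌊⌋-true (py ℤ.⊓ qy ℤ.≤? wy) y₁) (⌊⌋-true (wy ℤ.≤? py ℤ.⊔ qy) y₂)))

inRect-sideˡ : ∀ p q {y} → proj₂ p ℤ.⊓ proj₂ q ℤ.≤ y → y ℤ.≤ proj₂ p ℤ.⊔ proj₂ q →
               inRect p q (proj₁ p , y) ≡ true
inRect-sideˡ (px , _) (qx , _) = inRect-intro (ℕ.m⊓n≤m px qx) (ℕ.m≤m⊔n px qx)

inRect-sideʳ : ∀ p q {y} → proj₂ p ℤ.⊓ proj₂ q ℤ.≤ y → y ℤ.≤ proj₂ p ℤ.⊔ proj₂ q →
               inRect p q (proj₁ q , y) ≡ true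
inRect-sideʳ (px , _) (qx , _) = inRect-intro (ℕ.m⊓n≤n px qx) (ℕ.m≤n⊔m px qx)

<-⊓ : ∀ {i j k} → i ℤ.< j → i ℤ.< k → i ℤ.< j ℤ.⊓ k
<-⊓ {j = j} {k} i<j i<k with ℤ.⊓-sel j k
... | inj₁ j⊓k≡j rewrite j⊓k≡j = i<j
... | inj₂ j⊓k≡k rewrite j⊓k≡k = i<k

inRect-below : ∀ p q w → proj₂ w ℤ.< proj₂ p → proj₂ w ℤ.< proj₂ q → inRect p q w ≡ false
inRect-below (px , py) (qx , qy) (wx , wy) w<p w<q
  rewrite ⌊⌋-false (py ℤ.⊓ qy ℤ.≤? wy) (ℤ.<⇒≱ (<-⊓ w<p w<q)) =
    trans (cong (⌊ px ⊓ qx ℕ.≤? wx ⌋ ∧_) (∧-zeroʳ ⌊ wx ℕ.≤? px ⊔ qx ⌋)) (∧-zeroʳ _)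

doesNotBlock : Point → Point → Point → Bool
doesNotBlock p z w = not (inRect p z w) ∨ (w ==ᵖ z) ∨ (w ==ᵖ p)

emptyRect-blocked : ∀ {Y p z w} → w ∈ Y → inRect p z w ≡ true → w ≢ z → w ≢ p →
                    emptyRect Y p z ≡ false
emptyRect-blocked {p = p} {z} {w} (here refl) w∈□ w≢z w≢p
  rewrite w∈□ | ⌊⌋-false (≡-dec ℕ._≟_ ℤ._≟_ w z) w≢z | ⌊⌋-false (≡-dec ℕ._≟_ ℤ._≟_ w p) w≢p = refl
emptyRect-blocked {x ∷ Y} {p} {z} (there w∈Y) w∈□ w≢z w≢p =
  trans (cong (doesNotBlock p z x ∧_) (emptyRect-blocked {Y} {p} {z} w∈Y w∈□ w≢z w≢p)) (∧-zeroʳ _)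

emptyRect-++-outside : ∀ {M p z} L {Y} → All (λ w → inRect p z w ≡ false) M →
                       emptyRect (L ++ M ++ Y) p z ≡ emptyRect (L ++ Y) p z
emptyRect-++-outside {M} {p} {z} (x ∷ L) outside =
  cong (doesNotBlock p z x ∧_) (emptyRect-++-outside {M} {p} {z} L outside)
emptyRect-++-outside []      []      = refl
emptyRect-++-outside {_ ∷ M} {p} {z} [] (w∉□ ∷ outside)
  rewrite w∉□ = emptyRect-++-outside {M} {p} {z} [] outside

AboveAxis BelowAxis : Point → Set
AboveAxis w = 0ℤ ℤ.< proj₂ w
BelowAxis w = proj₂ w ℤ.< 0ℤ

touches : List Point → ℕ → ℤ → Point → Bool
touches Y s t z = not ⌊ proj₁ z ℕ.≟ s ⌋ ∧ emptyRect ((s , t) ∷ Y) (s , t) z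

touches-sameKey : ∀ Y s t y → touches Y s t (s , y) ≡ false
touches-sameKey _ s _ _ rewrite ⌊⌋-true (s ℕ.≟ s) refl = refl

touches-blocked : ∀ {Y s t z w} → w ∈ Y → inRect (s , t) z w ≡ true → w ≢ z → w ≢ (s , t) →
                  touches Y s t z ≡ false
touches-blocked {s = s} {t} {z} w∈Y w∈□ w≢z w≢p =
  trans (cong (not ⌊ proj₁ z ℕ.≟ s ⌋ ∧_)
              (emptyRect-blocked {_} {s , t} {z} (there w∈Y) w∈□ w≢z w≢p))
        (∧-zeroʳ _)

touches-++-below : ∀ {M} Y s {t} → 0ℤ ℤ.< t → All BelowAxis M → ∀ {z} → AboveAxis z →
                   touches (M ++ Y) s t z ≡ touches Y s t z
touches-++-below {M} Y s {t} 0<t below {z} 0<z =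
  cong (not ⌊ proj₁ z ℕ.≟ s ⌋ ∧_)
       (emptyRect-++-outside {M} {s , t} {z} [ s , t ] (All.map outside below))
  where
  outside : ∀ {w} → BelowAxis w → inRect (s , t) z w ≡ false
  outside {w} w<0 = inRect-below (s , t) z w (ℤ.<-trans w<0 0<t) (ℤ.<-trans w<0 0<z)

touchedKeys-++-untouched : ∀ {M X s t} →
  All (λ w → touches (M ++ X) s t w ≡ false) M →
  All (λ z → touches (M ++ X) s t z ≡ touches X s t z) X →
  touchedKeys (M ++ X) s t ≡ touchedKeys X s t
touchedKeys-++-untouched {M} {X} {s} {t} untouched agree =
  cong (deduplicate ℕ._≟_ ∘ map proj₁) (begin
  filterᵇ (touches (M ++ X) s t) (M ++ X)
    ≡⟨ filter-++ _ M X ⟩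
  filterᵇ (touches (M ++ X) s t) M ++ filterᵇ (touches (M ++ X) s t) X
    ≡⟨ cong₂ _++_ (filterᵇ-none untouched) (filterᵇ-cong agree) ⟩
  filterᵇ (touches X s t) X ∎)
  where open ≡-Reasoning

pastMirror-untouched : ∀ {Y} s {t k m} → (k , + suc m) ∈ Y → m < t →
                       touches Y s (+ suc t) (k , -[1+ m ]) ≡ false
pastMirror-untouched {Y} s {t} {k} {m} shadow∈Y m<t =
  touches-blocked {Y} {s} {+ suc t} {k , -[1+ m ]} shadow∈Y
    (inRect-sideʳ (s , + suc t) (k , -[1+ m ]) ℤ.-≤+ (ℤ.+≤+ (ℕ.s≤s (ℕ.<⇒≤ m<t))))
    (λ ())
    (λ shadow≡p → ℕ.<⇒≢ m<t (ℕ.suc-injective (ℤ.+-injective (cong proj₂ shadow≡p))))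

futureMirror-untouched : ∀ {Y s t} k {m} → (s , -[1+ t ]) ∈ Y → t < m →
                         touches Y s (+ suc t) (k , -[1+ m ]) ≡ false
futureMirror-untouched {Y} {s} {t} k {m} current∈Y t<m =
  touches-blocked {Y} {s} {+ suc t} {k , -[1+ m ]} current∈Y
    (inRect-sideˡ (s , + suc t) (k , -[1+ m ]) (ℤ.-≤- (ℕ.<⇒≤ t<m)) ℤ.-≤+)
    (λ current≡z → ℕ.<⇒≢ t<m (ℤ.-[1+-injective (cong proj₂ current≡z)))
    (λ ())

PastMirror : ℕ → List Point → Point → Set
PastMirror t X (k , y) = ∃[ m ] y ≡ -[1+ m ] × m < t × (k , + suc m) ∈ X

FutureMirror : ℕ → Point → Set
FutureMirror t (k , y) = ∃[ m ] y ≡ -[1+ m ] × t ≤ m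

mirrorFrom-future : ∀ t ss → All (FutureMirror t) (mirrorFrom (suc t) ss)
mirrorFrom-future t []       = []
mirrorFrom-future t (s ∷ ss) =
  (t , refl , ℕ.≤-refl) ∷
  All.map (λ { (m , y≡ , t<m) → m , y≡ , ℕ.<⇒≤ t<m }) (mirrorFrom-future (suc t) ss)

touchedKeys-mirror : ∀ {s ss t X Mp} → All AboveAxis X → All (PastMirror t X) Mp →
  touchedKeys ((Mp ++ mirrorFrom (suc t) (s ∷ ss)) ++ X) s (+ suc t) ≡ touchedKeys X s (+ suc t)
touchedKeys-mirror {s} {ss} {t} {X} {Mp} above past =
  touchedKeys-++-untouched {M} {X} {s} {+ suc t} untouched (All.map (λ {z} → agree {z}) above)
  where
  M : List Point
  M = Mp ++ mirrorFrom (suc t) (s ∷ ss)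

  future : All (FutureMirror (suc t)) (mirrorFrom (suc (suc t)) ss)
  future = mirrorFrom-future (suc t) ss

  pastUntouched : ∀ {w} → PastMirror t X w → touches (M ++ X) s (+ suc t) w ≡ false
  pastUntouched (m , refl , m<t , shadow∈X) = pastMirror-untouched s (∈-++⁺ʳ M shadow∈X) m<t

  futureUntouched : ∀ {w} → FutureMirror (suc t) w → touches (M ++ X) s (+ suc t) w ≡ false
  futureUntouched {k , _} (m , refl , t<m) =
    futureMirror-untouched k (∈-++⁺ˡ (∈-++⁺ʳ Mp (here refl))) t<m

  below : All BelowAxis M
  below = ++⁺ (All.map (λ { (_ , refl , _) → ℤ.-<+ }) past)
              (ℤ.-<+ ∷ All.map (λ { (_ , refl , _) → ℤ.-<+ }) future)

  agree : ∀ {z} → AboveAxis z → touches (M ++ X) s (+ suc t) z ≡ touches X s (+ suc t) z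
  agree {z} = touches-++-below {M} X s {+ suc t} (ℤ.+<+ ℕ.z<s) below {z}

  untouched : All (λ w → touches (M ++ X) s (+ suc t) w ≡ false) M
  untouched = ++⁺ {xs = Mp} (All.map pastUntouched past)
                  (touches-sameKey (M ++ X) s (+ suc t) -[1+ t ] ∷
                   All.map (λ {w} → futureUntouched {w}) future)

greedyRun-mirror : ∀ ss t X Mp → All AboveAxis X → All (PastMirror t X) Mp →
  proj₂ (greedyRun ((Mp ++ mirrorFrom (suc t) ss) ++ X) (suc t) ss) ≡ proj₂ (greedyRun X (suc t) ss)
greedyRun-mirror []       t X Mp above past = refl
greedyRun-mirror (s ∷ ss) t X Mp above past = begin
  length (keys Y) ℕ.+ rest (Y ++ row (keys Y))
    ≡⟨ cong (λ K → length K ℕ.+ rest (Y ++ row K)) (touchedKeys-mirror above past) ⟩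
  length K ℕ.+ rest (Y ++ row K)
    ≡⟨ cong (λ Z → length K ℕ.+ rest Z) reassociate ⟩
  length K ℕ.+ rest (((Mp ++ [ current ]) ++ mirrorFrom (suc (suc t)) ss) ++ (X ++ row K))
    ≡⟨ cong (length K ℕ.+_)
            (greedyRun-mirror ss (suc t) (X ++ row K) (Mp ++ [ current ]) above′ past′) ⟩
  length K ℕ.+ rest (X ++ row K) ∎
  where
  open ≡-Reasoning

  T : ℤ
  T = + suc t

  current : Point
  current = (s , -[1+ t ])

  Y : List Point
  Y = (Mp ++ mirrorFrom (suc t) (s ∷ ss)) ++ X

  keys : List Point → List ℕ
  keys Z = touchedKeys Z s T

  K : List ℕ
  K = keys X

  row : List ℕ → List Point
  row ks = (s , T) ∷ map (λ x → (x , T)) ks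

  rest : List Point → ℕ
  rest Z = proj₂ (greedyRun Z (suc (suc t)) ss)

  reassociate : Y ++ row K ≡ ((Mp ++ [ current ]) ++ mirrorFrom (suc (suc t)) ss) ++ (X ++ row K)
  reassociate =
    trans (++-assoc (Mp ++ mirrorFrom (suc t) (s ∷ ss)) X (row K))
          (cong (_++ (X ++ row K)) (sym (++-assoc Mp [ current ] (mirrorFrom (suc (suc t)) ss))))

  above′ : All AboveAxis (X ++ row K)
  above′ = ++⁺ above (ℤ.+<+ ℕ.z<s ∷ map⁺ (All.universal (λ _ → ℤ.+<+ ℕ.z<s) K))

  past′ : All (PastMirror (suc t) (X ++ row K)) (Mp ++ [ current ])
  past′ = ++⁺ (All.map (λ { (m , y≡ , m<t , shadow∈X) → m , y≡ , ℕ.m≤n⇒m≤1+n m<t , ∈-++⁺ˡ shadow∈X })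
                       past)
              ((t , refl , ℕ.≤-refl , ∈-++⁺ʳ X (here refl)) ∷ [])

lemma1 : (n : ℕ) → 1 ≤ n → (σ : Fin n → Fin n) → Injective _≡_ _≡_ σ →
    Greedy (mirror (seqOf σ)) (seqOf σ) ≡ Greedy flatTree (seqOf σ)
lemma1 n _ σ _ =
  cong (length S ℕ.+_)
    (trans (cong (λ Z → proj₂ (greedyRun Z 1 S)) (sym (++-identityʳ (mirror S))))
           (greedyRun-mirror S 0 [] [] [] []))
  where
  S : List ℕ
  S = seqOf σ
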